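{- Let $\mathbf{T}$ be a rooted binary tree with root $o$ and $n\ge2$ leaves, and let $\mathbf{T}'$ and $\mathbf{T}''$ be the subtrees rooted at the two children of $o$ (each consisting of a child of $o$ and all its descendants). Let $(Y_1,\dots,Y_n)$ be a uniformly random ordering of the leaves and $W_k=\mathbf{W}_\mathbf{T}(\{Y_1,\dots,Y_k\})$ for $2\le k\le n$, with the convention $W_1:=0$. Set $m:=\sup\{1\le k<n:\mathbb{P}\{W_k=2k-2\}>0\}$. Then $W_m=2m-2$ if and only if $Y_1,\dots,Y_m$ are leaves of $\mathbf{T}'$ and $Y_{m+1},\dots,Y_n$ are leaves of $\mathbf{T}''$, or vice versa (with the roles of $\mathbf{T}'$ and $\mathbf{T}''$ interchanged).
   Context: A rooted binary tree is a finite tree with exactly one vertex (the root) of degree $2$ and all other vertices of degree $3$ or $1$; all edges have length $1$. Children and descendants are with respect to the root. For a set $K$ of leaves, $\mathbf{W}_\mathbf{T}(K)$ is the number of edges of the smallest connected subgraph of $\mathbf{T}$ containing $K$. -}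

module Defs where

open import Data.Nat using (ℕ; zero; suc; _+_; _*_; _∸_; _≤_; _<_; _<ᵇ_)
open import Data.Bool using (Bool; true; false; _∨_)
open import Data.Fin using (Fin; toℕ)
open import Data.Fin.Subset using (Subset)
open import Data.Fin.Permutation using (Permutation′; _⟨$⟩ʳ_; _⟨$⟩ˡ_)
open import Data.Vec using (Vec; []; _∷_; take; drop; tabulate)
open import Data.Product using (_×_; ∃)
open import Data.Sum using (_⊎_)
open import Relation.Binary.PropositionalEquality using (_≡_)

-- Rooted binary trees (up to isomorphism, with a left/right ordering of
-- children).  'leaf' is a single vertex; 'node l r' is a root of degree 2
-- whose two children are the roots of l and r (every non-root internal
-- vertex then has degree 3).
data Tree : Set where
  leaf : Tree
  node : Tree → Tree → Tree

-- number of leaves; leaves of t are indexed by Fin (size t), left to right: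
-- in 'node l r' the first 'size l' indices are the leaves of l.
size : Tree → ℕ
size leaf = 1
size (node l r) = size l + size r

nonempty : ∀ {n} → Subset n → Bool
nonempty [] = false
nonempty (b ∷ K) = b ∨ nonempty K

-- R t K : number of edges of the smallest connected subgraph of t
-- containing K together with the root of t.
R : (t : Tree) → Subset (size t) → ℕ
R leaf K = 0
R (node l r) K = side l (take (size l) K) + side r (drop (size l) K)
  where
  side : (s : Tree) → Subset (size s) → ℕ
  side s Ks with nonempty Ks
  ... | true  = suc (R s Ks)
  ... | false = 0

-- W t K : number of edges of the smallest connected subgraph of t
-- containing the set K of leaves (0 if K has at most one element).
W : (t : Tree) → Subset (size t) → ℕ
W leaf K = 0
W (node l r) K = go (nonempty Kl) (nonempty Kr)
  where
  Kl = take (size l) K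
  Kr = drop (size l) K
  go : Bool → Bool → ℕ
  go true  true  = R (node l r) K
  go true  false = W l Kl
  go false true  = W r Kr
  go false false = 0

-- An ordering (Y_1,…,Y_n) of the leaves is a permutation π of Fin n,
-- with Y_{i+1} = π ⟨$⟩ʳ i (0-based index i).
-- firstK π k = {Y_1,…,Y_k}.
firstK : ∀ {n} → Permutation′ n → ℕ → Subset n
firstK π k = tabulate (λ j → toℕ (π ⟨$⟩ˡ j) <ᵇ k)

Wk : (t : Tree) → Permutation′ (size t) → ℕ → ℕ
Wk t π k = W t (firstK π k)

-- "P{W_k = 2k-2} > 0" for a uniform random ordering: some ordering achieves it.
Admissible : Tree → ℕ → Set
Admissible t k = 1 ≤ k × k < size t × ∃ λ (π : Permutation′ (size t)) → Wk t π k ≡ 2 * k ∸ 2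

-- m is the supremum (= maximum, the set being finite) of the admissible k.
IsSupAdm : Tree → ℕ → Set
IsSupAdm t m = Admissible t m × (∀ k → Admissible t k → k ≤ m)

SplitLR : (l r : Tree) → Permutation′ (size (node l r)) → ℕ → Set
SplitLR l r π m =
  (∀ i → toℕ i < m → toℕ (π ⟨$⟩ʳ i) < size l) ×
  (∀ i → m ≤ toℕ i → size l ≤ toℕ (π ⟨$⟩ʳ i))

SplitRL : (l r : Tree) → Permutation′ (size (node l r)) → ℕ → Set
SplitRL l r π m =
  (∀ i → toℕ i < m → size l ≤ toℕ (π ⟨$⟩ʳ i)) ×
  (∀ i → m ≤ toℕ i → toℕ (π ⟨$⟩ʳ i) < size l)

-- The hull R t K of a nonempty leaf set K together with the root has at least
-- 2|K| - 2 edges, with equality only when K is the set of all leaves.  Hence a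
-- leaf set K of T with |K| < n and W_T(K) = 2|K| - 2 cannot meet both subtrees
-- (there W_T(K) = R T K), so it lies in one of them.  Both subtrees are
-- themselves such sets (ordering T′ first, resp. T″ first), so m is at least
-- their sizes; then {Y_1,…,Y_m} lying in one subtree must be all of it.
module Submission where

open import Defs
open import Data.Bool using (Bool; true; false; _∨_; not)
open import Data.Fin using (Fin; toℕ; opposite)
open import Data.Fin.Properties using (toℕ<n; opposite-prop)
open import Data.Fin.Permutation using (Permutation′; _⟨$⟩ʳ_; _⟨$⟩ˡ_; inverseˡ; inverseʳ; flip; reverse)
import Data.Fin.Permutation as Perm
open import Data.Fin.Subset using (Subset; ⊤; ⊥; ∣_∣)
open import Data.Fin.Subset.Properties using (∣p∣≤n; ∣⊤∣≡n; ∣⊥∣≡0; ∣p∣≡n⇒p≡⊤)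
open import Data.Nat using (ℕ; zero; suc; _+_; _*_; _∸_; _≤_; _<_; _<ᵇ_; _⊓_; z≤n; s≤s)
open import Data.Nat.Properties
open import Data.Nat.Tactic.RingSolver using (solve-∀)
open import Data.Product using (_×_; _,_; proj₁; proj₂)
open import Data.Sum using (_⊎_; inj₁; inj₂)
import Data.Sum as Sum
open import Data.Vec using (Vec; []; _∷_; _++_; take; drop; tabulate; replicate; lookup)
open import Data.Vec.Properties using (take++drop≡id; ++-injective; tabulate-cong; lookup∘tabulate)
open import Function using (_∘_; _⇔_; mk⇔; Equivalence)
open import Relation.Binary.PropositionalEquality
open import Relation.Nullary using (¬_; contradiction)
open import Relation.Nullary.Reflects using (Reflects; ofʸ; ofⁿ)
open import Algebra.Properties.CommutativeMonoid.Sum +-0-commutativeMonoid using (sum; sum-permute)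

take-drop-++ : ∀ {A : Set} {m n} (xs : Vec A m) (ys : Vec A n) →
               take m (xs ++ ys) ≡ xs × drop m (xs ++ ys) ≡ ys
take-drop-++ {m = m} xs ys = ++-injective (take m (xs ++ ys)) xs (take++drop≡id m (xs ++ ys))

replicate-++ : ∀ {A : Set} m n (x : A) → replicate m x ++ replicate n x ≡ replicate (m + n) x
replicate-++ zero    n x = refl
replicate-++ (suc m) n x = cong (x ∷_) (replicate-++ m n x)

∣p++q∣ : ∀ {m n} (p : Subset m) (q : Subset n) → ∣ p ++ q ∣ ≡ ∣ p ∣ + ∣ q ∣
∣p++q∣ []          q = refl
∣p++q∣ (true ∷ p)  q = cong suc (∣p++q∣ p q)
∣p++q∣ (false ∷ p) q = ∣p++q∣ p q

nonempty-++ : ∀ {m n} (p : Subset m) (q : Subset n) → nonempty (p ++ q) ≡ nonempty p ∨ nonempty q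
nonempty-++ []          q = refl
nonempty-++ (true ∷ p)  q = refl
nonempty-++ (false ∷ p) q = nonempty-++ p q

nonempty≡false⇒≡⊥ : ∀ {n} (p : Subset n) → nonempty p ≡ false → p ≡ ⊥
nonempty≡false⇒≡⊥ []          _ = refl
nonempty≡false⇒≡⊥ (false ∷ p) e = cong (false ∷_) (nonempty≡false⇒≡⊥ p e)

nonempty-⊥ : ∀ n → nonempty (⊥ {n}) ≡ false
nonempty-⊥ zero    = refl
nonempty-⊥ (suc n) = nonempty-⊥ n

nonempty-⊤ : ∀ {n} → 1 ≤ n → nonempty (⊤ {n}) ≡ true
nonempty-⊤ (s≤s _) = refl

leftLeaves : ∀ a b → Subset (a + b)
leftLeaves a b = ⊤ {a} ++ ⊥ {b}

rightLeaves : ∀ a b → Subset (a + b)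
rightLeaves a b = ⊥ {a} ++ ⊤ {b}

∣leftLeaves∣ : ∀ a b → ∣ leftLeaves a b ∣ ≡ a
∣leftLeaves∣ a b = trans (∣p++q∣ (⊤ {a}) (⊥ {b})) (trans (cong₂ _+_ (∣⊤∣≡n a) (∣⊥∣≡0 b)) (+-identityʳ a))

∣rightLeaves∣ : ∀ a b → ∣ rightLeaves a b ∣ ≡ b
∣rightLeaves∣ a b = trans (∣p++q∣ (⊥ {a}) (⊤ {b})) (cong₂ _+_ (∣⊥∣≡0 a) (∣⊤∣≡n b))

indicator : Bool → ℕ
indicator true  = 1
indicator false = 0

∣tabulate∣ : ∀ {n} (f : Fin n → Bool) → ∣ tabulate f ∣ ≡ sum (indicator ∘ f)
∣tabulate∣ {zero}  f = refl
∣tabulate∣ {suc n} f with f Fin.zero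
... | true  = cong suc (∣tabulate∣ (f ∘ Fin.suc))
... | false = ∣tabulate∣ (f ∘ Fin.suc)

∣tabulate∘permute∣ : ∀ {n} (f : Fin n → Bool) (π : Permutation′ n) →
                     ∣ tabulate (f ∘ (π ⟨$⟩ʳ_)) ∣ ≡ ∣ tabulate f ∣
∣tabulate∘permute∣ f π = trans (∣tabulate∣ (f ∘ (π ⟨$⟩ʳ_)))
  (trans (sym (sum-permute (indicator ∘ f) π)) (sym (∣tabulate∣ f)))

∣tabulate-<ᵇ∣ : ∀ n k → ∣ tabulate {n = n} (λ i → toℕ i <ᵇ k) ∣ ≡ n ⊓ k
∣tabulate-<ᵇ∣ zero    k       = refl
∣tabulate-<ᵇ∣ (suc n) zero    = trans (∣tabulate-<ᵇ∣ n zero) (⊓-zeroʳ n)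
∣tabulate-<ᵇ∣ (suc n) (suc k) = cong suc (∣tabulate-<ᵇ∣ n k)

∣firstK∣ : ∀ {n} (π : Permutation′ n) {k} → k ≤ n → ∣ firstK π k ∣ ≡ k
∣firstK∣ {n} π {k} k≤n =
  trans (∣tabulate∘permute∣ (λ i → toℕ i <ᵇ k) (flip π))
        (trans (∣tabulate-<ᵇ∣ n k) (m≥n⇒m⊓n≡n k≤n))

<ᵇ≡⇔ : ∀ {Q : Set} {c} → Reflects Q c → ∀ x k →
       (x <ᵇ k) ≡ c ⇔ ((x < k → Q) × (k ≤ x → ¬ Q))
<ᵇ≡⇔ rQ x k with x <ᵇ k | <ᵇ-reflects-< x k | rQ
... | true  | ofʸ x<k  | ofʸ q  = mk⇔ (λ _ → (λ _ → q) , λ k≤x → contradiction x<k (≤⇒≯ k≤x)) (λ _ → refl)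
... | true  | ofʸ x<k  | ofⁿ ¬q = mk⇔ (λ ()) (λ (below , _) → contradiction (below x<k) ¬q)
... | false | ofⁿ x≮k  | ofʸ q  = mk⇔ (λ ()) (λ (_ , above) → contradiction q (above (≮⇒≥ x≮k)))
... | false | ofⁿ x≮k  | ofⁿ ¬q = mk⇔ (λ _ → (λ x<k → contradiction x<k x≮k) , λ _ → ¬q) (λ _ → refl)

≤-reflects-not-<ᵇ : ∀ a y → Reflects (a ≤ y) (not (y <ᵇ a))
≤-reflects-not-<ᵇ a y with y <ᵇ a | <ᵇ-reflects-< y a
... | true  | ofʸ y<a = ofⁿ (<⇒≱ y<a)
... | false | ofⁿ y≮a = ofʸ (≮⇒≥ y≮a)

module _ {n} (π : Permutation′ n) (k : ℕ) (p : Fin n → Bool) where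

  firstK≡tabulate : (∀ i → (toℕ i <ᵇ k) ≡ p (π ⟨$⟩ʳ i)) → firstK π k ≡ tabulate p
  firstK≡tabulate h = tabulate-cong (λ j → trans (h (π ⟨$⟩ˡ j)) (cong p (inverseʳ π)))

  firstK≡tabulate⁻¹ : firstK π k ≡ tabulate p → ∀ i → (toℕ i <ᵇ k) ≡ p (π ⟨$⟩ʳ i)
  firstK≡tabulate⁻¹ e i = begin
    toℕ i <ᵇ k                         ≡⟨ cong (λ j → toℕ j <ᵇ k) (inverseˡ π) ⟨
    toℕ (π ⟨$⟩ˡ (π ⟨$⟩ʳ i)) <ᵇ k       ≡⟨ lookup∘tabulate _ (π ⟨$⟩ʳ i) ⟨
    lookup (firstK π k) (π ⟨$⟩ʳ i)     ≡⟨ cong (λ K → lookup K (π ⟨$⟩ʳ i)) e ⟩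
    lookup (tabulate p) (π ⟨$⟩ʳ i)     ≡⟨ lookup∘tabulate p (π ⟨$⟩ʳ i) ⟩
    p (π ⟨$⟩ʳ i)                       ∎
    where open ≡-Reasoning

replicate≡tabulate : ∀ {A : Set} n (x : A) → replicate n x ≡ tabulate (λ _ → x)
replicate≡tabulate zero    x = refl
replicate≡tabulate (suc n) x = cong (x ∷_) (replicate≡tabulate n x)

leftLeaves≡tabulate : ∀ a b → leftLeaves a b ≡ tabulate (λ j → toℕ j <ᵇ a)
leftLeaves≡tabulate zero    b = replicate≡tabulate b false
leftLeaves≡tabulate (suc a) b = cong (true ∷_) (leftLeaves≡tabulate a b)

rightLeaves≡tabulate : ∀ a b → rightLeaves a b ≡ tabulate (λ j → not (toℕ j <ᵇ a))
rightLeaves≡tabulate zero    b = replicate≡tabulate b true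
rightLeaves≡tabulate (suc a) b = cong (false ∷_) (rightLeaves≡tabulate a b)

module _ (l r : Tree) (π : Permutation′ (size l + size r)) (k : ℕ) where

  private
    leaf< : ∀ i → Reflects (toℕ (π ⟨$⟩ʳ i) < size l) (toℕ (π ⟨$⟩ʳ i) <ᵇ size l)
    leaf< i = <ᵇ-reflects-< (toℕ (π ⟨$⟩ʳ i)) (size l)
    leaf≥ : ∀ i → Reflects (size l ≤ toℕ (π ⟨$⟩ʳ i)) (not (toℕ (π ⟨$⟩ʳ i) <ᵇ size l))
    leaf≥ i = ≤-reflects-not-<ᵇ (size l) (toℕ (π ⟨$⟩ʳ i))

  SplitLR⇒firstK : SplitLR l r π k → firstK π k ≡ leftLeaves (size l) (size r)
  SplitLR⇒firstK (below , above) = trans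
    (firstK≡tabulate π k _ (λ i → Equivalence.from (<ᵇ≡⇔ (leaf< i) (toℕ i) k)
      (below i , ≤⇒≯ ∘ above i)))
    (sym (leftLeaves≡tabulate (size l) (size r)))

  firstK⇒SplitLR : firstK π k ≡ leftLeaves (size l) (size r) → SplitLR l r π k
  firstK⇒SplitLR e = (λ i → proj₁ (split i)) , (λ i → ≮⇒≥ ∘ proj₂ (split i))
    where
    split : ∀ i → (toℕ i < k → toℕ (π ⟨$⟩ʳ i) < size l) × (k ≤ toℕ i → ¬ toℕ (π ⟨$⟩ʳ i) < size l)
    split i = Equivalence.to (<ᵇ≡⇔ (leaf< i) (toℕ i) k)
      (firstK≡tabulate⁻¹ π k _ (trans e (leftLeaves≡tabulate (size l) (size r))) i)

  SplitRL⇒firstK : SplitRL l r π k → firstK π k ≡ rightLeaves (size l) (size r)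
  SplitRL⇒firstK (below , above) = trans
    (firstK≡tabulate π k _ (λ i → Equivalence.from (<ᵇ≡⇔ (leaf≥ i) (toℕ i) k)
      (below i , <⇒≱ ∘ above i)))
    (sym (rightLeaves≡tabulate (size l) (size r)))

  firstK⇒SplitRL : firstK π k ≡ rightLeaves (size l) (size r) → SplitRL l r π k
  firstK⇒SplitRL e = (λ i → proj₁ (split i)) , (λ i → ≰⇒> ∘ proj₂ (split i))
    where
    split : ∀ i → (toℕ i < k → size l ≤ toℕ (π ⟨$⟩ʳ i)) × (k ≤ toℕ i → ¬ size l ≤ toℕ (π ⟨$⟩ʳ i))
    split i = Equivalence.to (<ᵇ≡⇔ (leaf≥ i) (toℕ i) k)
      (firstK≡tabulate⁻¹ π k _ (trans e (rightLeaves≡tabulate (size l) (size r))) i)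

-- Hulls of leaf sets

1≤size : ∀ t → 1 ≤ size t
1≤size leaf       = s≤s z≤n
1≤size (node l r) = ≤-trans (1≤size l) (m≤m+n (size l) (size r))

module Node (l r : Tree) (K : Subset (size l + size r)) where

  Kˡ : Subset (size l)
  Kˡ = take (size l) K

  Kʳ : Subset (size r)
  Kʳ = drop (size l) K

  K≡Kˡ++Kʳ : K ≡ Kˡ ++ Kʳ
  K≡Kˡ++Kʳ = sym (take++drop≡id (size l) K)

  ∣K∣≡ : ∣ K ∣ ≡ ∣ Kˡ ∣ + ∣ Kʳ ∣
  ∣K∣≡ = trans (cong ∣_∣ K≡Kˡ++Kʳ) (∣p++q∣ Kˡ Kʳ)

  ∣K∣≡∣Kˡ∣ : Kʳ ≡ ⊥ → ∣ K ∣ ≡ ∣ Kˡ ∣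
  ∣K∣≡∣Kˡ∣ Kʳ≡⊥ = trans ∣K∣≡ (trans (cong (λ Kʳ → ∣ Kˡ ∣ + ∣ Kʳ ∣) Kʳ≡⊥)
                                   (trans (cong (∣ Kˡ ∣ +_) (∣⊥∣≡0 (size r))) (+-identityʳ ∣ Kˡ ∣)))

  ∣K∣≡∣Kʳ∣ : Kˡ ≡ ⊥ → ∣ K ∣ ≡ ∣ Kʳ ∣
  ∣K∣≡∣Kʳ∣ Kˡ≡⊥ = trans ∣K∣≡ (trans (cong (λ Kˡ → ∣ Kˡ ∣ + ∣ Kʳ ∣) Kˡ≡⊥)
                                   (cong (_+ ∣ Kʳ ∣) (∣⊥∣≡0 (size l))))

  nonempty-K : nonempty K ≡ nonempty Kˡ ∨ nonempty Kʳ
  nonempty-K = trans (cong nonempty K≡Kˡ++Kʳ) (nonempty-++ Kˡ Kʳ)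

  module _ (eˡ : nonempty Kˡ ≡ true) (eʳ : nonempty Kʳ ≡ true) where
    R-both : R (node l r) K ≡ suc (R l Kˡ) + suc (R r Kʳ)
    R-both rewrite eˡ | eʳ = refl
    W-both : W (node l r) K ≡ R (node l r) K
    -- after the rewrite the left side unfolds to R (node l r) K with its tests not yet rewritten
    W-both rewrite eˡ | eʳ = R-both

  module _ (eˡ : nonempty Kˡ ≡ true) (eʳ : nonempty Kʳ ≡ false) where
    R-onlyˡ : R (node l r) K ≡ suc (R l Kˡ) + 0
    R-onlyˡ rewrite eˡ | eʳ = refl
    W-onlyˡ : W (node l r) K ≡ W l Kˡ
    W-onlyˡ rewrite eˡ | eʳ = refl

  module _ (eˡ : nonempty Kˡ ≡ false) (eʳ : nonempty Kʳ ≡ true) where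
    R-onlyʳ : R (node l r) K ≡ suc (R r Kʳ)
    R-onlyʳ rewrite eˡ | eʳ = refl
    W-onlyʳ : W (node l r) K ≡ W r Kʳ
    W-onlyʳ rewrite eˡ | eʳ = refl

two-root-edges : ∀ x y → suc x + suc y + 2 ≡ (x + 2) + (y + 2)
two-root-edges = solve-∀

module Full (l r : Tree) where
  open Node l r ⊤ public

  parts : Kˡ ≡ ⊤ × Kʳ ≡ ⊤
  parts = subst (λ K → take (size l) K ≡ ⊤ × drop (size l) K ≡ ⊤)
                (replicate-++ (size l) (size r) true) (take-drop-++ ⊤ ⊤)

  nonempty-Kˡ : nonempty Kˡ ≡ true
  nonempty-Kˡ = trans (cong nonempty (proj₁ parts)) (nonempty-⊤ (1≤size l))

  nonempty-Kʳ : nonempty Kʳ ≡ true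
  nonempty-Kʳ = trans (cong nonempty (proj₂ parts)) (nonempty-⊤ (1≤size r))

R-full : ∀ t → R t ⊤ + 2 ≡ 2 * size t
R-full leaf       = refl
R-full (node l r) = begin
  R (node l r) ⊤ + 2                   ≡⟨ cong (_+ 2) (R-both nonempty-Kˡ nonempty-Kʳ) ⟩
  suc (R l Kˡ) + suc (R r Kʳ) + 2      ≡⟨ cong₂ (λ Kˡ Kʳ → suc (R l Kˡ) + suc (R r Kʳ) + 2) (proj₁ parts) (proj₂ parts) ⟩
  suc (R l ⊤) + suc (R r ⊤) + 2        ≡⟨ two-root-edges (R l ⊤) (R r ⊤) ⟩
  (R l ⊤ + 2) + (R r ⊤ + 2)            ≡⟨ cong₂ _+_ (R-full l) (R-full r) ⟩
  2 * size l + 2 * size r              ≡⟨ *-distribˡ-+ 2 (size l) (size r) ⟨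
  2 * (size l + size r)                ∎
  where open ≡-Reasoning
        open Full l r

W-full : ∀ t → W t ⊤ ≡ 2 * size t ∸ 2
W-full leaf       = refl
W-full (node l r) = begin
  W (node l r) ⊤            ≡⟨ W-both nonempty-Kˡ nonempty-Kʳ ⟩
  R (node l r) ⊤            ≡⟨ m+n∸n≡m _ 2 ⟨
  R (node l r) ⊤ + 2 ∸ 2    ≡⟨ cong (_∸ 2) (R-full (node l r)) ⟩
  2 * size (node l r) ∸ 2   ∎
  where open ≡-Reasoning
        open Full l r

StrictUnlessFull : (t : Tree) → Subset (size t) → Set
StrictUnlessFull t K = K ≡ ⊤ ⊎ 2 * ∣ K ∣ < R t K + 2

StrictUnlessFull⇒≤ : ∀ t {K} → StrictUnlessFull t K → 2 * ∣ K ∣ ≤ R t K + 2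
StrictUnlessFull⇒≤ t (inj₁ refl) = ≤-reflexive (trans (cong (2 *_) (∣⊤∣≡n (size t))) (sym (R-full t)))
StrictUnlessFull⇒≤ t (inj₂ lt)   = <⇒≤ lt

module _ (l r : Tree) (K : Subset (size l + size r)) where
  open Node l r K

  private
    2∣K∣≡ : 2 * ∣ K ∣ ≡ 2 * ∣ Kˡ ∣ + 2 * ∣ Kʳ ∣
    2∣K∣≡ = trans (cong (2 *_) ∣K∣≡) (*-distribˡ-+ 2 ∣ Kˡ ∣ ∣ Kʳ ∣)

    <-from-parts : nonempty Kˡ ≡ true → nonempty Kʳ ≡ true →
                   2 * ∣ Kˡ ∣ + 2 * ∣ Kʳ ∣ < (R l Kˡ + 2) + (R r Kʳ + 2) → 2 * ∣ K ∣ < R (node l r) K + 2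
    <-from-parts eˡ eʳ = subst₂ _<_ (sym 2∣K∣≡)
      (sym (trans (cong (_+ 2) (R-both eˡ eʳ)) (two-root-edges (R l Kˡ) (R r Kʳ))))

  strictUnlessFull-both : nonempty Kˡ ≡ true → nonempty Kʳ ≡ true →
                          StrictUnlessFull l Kˡ → StrictUnlessFull r Kʳ → StrictUnlessFull (node l r) K
  strictUnlessFull-both eˡ eʳ (inj₁ Kˡ≡⊤) (inj₁ Kʳ≡⊤) =
    inj₁ (trans K≡Kˡ++Kʳ (trans (cong₂ _++_ Kˡ≡⊤ Kʳ≡⊤) (replicate-++ (size l) (size r) true)))
  strictUnlessFull-both eˡ eʳ (inj₂ ltˡ) bʳ =
    inj₂ (<-from-parts eˡ eʳ (+-mono-<-≤ ltˡ (StrictUnlessFull⇒≤ r bʳ)))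
  strictUnlessFull-both eˡ eʳ bˡ@(inj₁ _) (inj₂ ltʳ) =
    inj₂ (<-from-parts eˡ eʳ (+-mono-≤-< (StrictUnlessFull⇒≤ l bˡ) ltʳ))

  strictUnlessFull-onlyˡ : nonempty Kˡ ≡ true → nonempty Kʳ ≡ false →
                           StrictUnlessFull l Kˡ → StrictUnlessFull (node l r) K
  strictUnlessFull-onlyˡ eˡ eʳ bˡ = inj₂ (subst₂ _<_
    (cong (2 *_) (sym (∣K∣≡∣Kˡ∣ (nonempty≡false⇒≡⊥ Kʳ eʳ))))
    (cong (_+ 2) (sym (trans (R-onlyˡ eˡ eʳ) (cong suc (+-identityʳ (R l Kˡ))))))
    (s≤s (StrictUnlessFull⇒≤ l bˡ)))

  strictUnlessFull-onlyʳ : nonempty Kˡ ≡ false → nonempty Kʳ ≡ true →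
                           StrictUnlessFull r Kʳ → StrictUnlessFull (node l r) K
  strictUnlessFull-onlyʳ eˡ eʳ bʳ = inj₂ (subst₂ _<_
    (cong (2 *_) (sym (∣K∣≡∣Kʳ∣ (nonempty≡false⇒≡⊥ Kˡ eˡ))))
    (cong (_+ 2) (sym (R-onlyʳ eˡ eʳ)))
    (s≤s (StrictUnlessFull⇒≤ r bʳ)))

R-strictUnlessFull : ∀ t (K : Subset (size t)) → nonempty K ≡ true → StrictUnlessFull t K
R-strictUnlessFull leaf       (true ∷ []) _  = inj₁ refl
R-strictUnlessFull (node l r) K           ne = cases _ refl _ refl
  where
  open Node l r K
  -- not 'with nonempty Kˡ': that would also abstract the tests hidden inside R in the goal
  cases : ∀ bˡ → nonempty Kˡ ≡ bˡ → ∀ bʳ → nonempty Kʳ ≡ bʳ → StrictUnlessFull (node l r) K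
  cases true  eˡ true  eʳ =
    strictUnlessFull-both l r K eˡ eʳ (R-strictUnlessFull l Kˡ eˡ) (R-strictUnlessFull r Kʳ eʳ)
  cases true  eˡ false eʳ = strictUnlessFull-onlyˡ l r K eˡ eʳ (R-strictUnlessFull l Kˡ eˡ)
  cases false eˡ true  eʳ = strictUnlessFull-onlyʳ l r K eˡ eʳ (R-strictUnlessFull r Kʳ eʳ)
  cases false eˡ false eʳ = contradiction (trans (sym ne) (trans nonempty-K (cong₂ _∨_ eˡ eʳ))) λ ()

module _ (l r : Tree) (K : Subset (size l + size r)) where
  open Node l r K

  tight⇒one-sided : ∣ K ∣ < size l + size r → W (node l r) K + 2 ≡ 2 * ∣ K ∣ → Kʳ ≡ ⊥ ⊎ Kˡ ≡ ⊥
  tight⇒one-sided ∣K∣<n tight = cases _ refl _ refl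
    where
    cases : ∀ bˡ → nonempty Kˡ ≡ bˡ → ∀ bʳ → nonempty Kʳ ≡ bʳ → Kʳ ≡ ⊥ ⊎ Kˡ ≡ ⊥
    cases false eˡ _     _  = inj₂ (nonempty≡false⇒≡⊥ Kˡ eˡ)
    cases true  _  false eʳ = inj₁ (nonempty≡false⇒≡⊥ Kʳ eʳ)
    cases true  eˡ true  eʳ with R-strictUnlessFull (node l r) K (trans nonempty-K (cong₂ _∨_ eˡ eʳ))
    ... | inj₁ K≡⊤ = contradiction (trans (cong ∣_∣ K≡⊤) (∣⊤∣≡n _)) (<⇒≢ ∣K∣<n)
    ... | inj₂ lt  = contradiction (subst (2 * ∣ K ∣ <_) R+2≡2∣K∣ lt) (n≮n _)
      where
      R+2≡2∣K∣ : R (node l r) K + 2 ≡ 2 * ∣ K ∣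
      R+2≡2∣K∣ = trans (cong (_+ 2) (sym (W-both eˡ eʳ))) tight

  one-sided⇒leftLeaves : Kʳ ≡ ⊥ → size l ≤ ∣ K ∣ → K ≡ leftLeaves (size l) (size r)
  one-sided⇒leftLeaves Kʳ≡⊥ l≤∣K∣ = trans K≡Kˡ++Kʳ (cong₂ _++_ (∣p∣≡n⇒p≡⊤ ∣Kˡ∣≡l) Kʳ≡⊥)
    where
    ∣Kˡ∣≡l : ∣ Kˡ ∣ ≡ size l
    ∣Kˡ∣≡l = ≤-antisym (∣p∣≤n Kˡ) (subst (size l ≤_) (∣K∣≡∣Kˡ∣ Kʳ≡⊥) l≤∣K∣)

  one-sided⇒rightLeaves : Kˡ ≡ ⊥ → size r ≤ ∣ K ∣ → K ≡ rightLeaves (size l) (size r)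
  one-sided⇒rightLeaves Kˡ≡⊥ r≤∣K∣ = trans K≡Kˡ++Kʳ (cong₂ _++_ Kˡ≡⊥ (∣p∣≡n⇒p≡⊤ ∣Kʳ∣≡r))
    where
    ∣Kʳ∣≡r : ∣ Kʳ ∣ ≡ size r
    ∣Kʳ∣≡r = ≤-antisym (∣p∣≤n Kʳ) (subst (size r ≤_) (∣K∣≡∣Kʳ∣ Kˡ≡⊥) r≤∣K∣)

  tight⇒subtree : ∀ {k} → ∣ K ∣ ≡ k → k < size l + size r → size l ≤ k → size r ≤ k →
                  W (node l r) K + 2 ≡ 2 * k →
                  K ≡ leftLeaves (size l) (size r) ⊎ K ≡ rightLeaves (size l) (size r)
  tight⇒subtree refl ∣K∣<n l≤∣K∣ r≤∣K∣ tight =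
    Sum.map (λ Kʳ≡⊥ → one-sided⇒leftLeaves Kʳ≡⊥ l≤∣K∣) (λ Kˡ≡⊥ → one-sided⇒rightLeaves Kˡ≡⊥ r≤∣K∣)
            (tight⇒one-sided ∣K∣<n tight)

module _ (l r : Tree) where

  W-leftLeaves : W (node l r) (leftLeaves (size l) (size r)) ≡ 2 * size l ∸ 2
  W-leftLeaves = begin
    W (node l r) (leftLeaves (size l) (size r))   ≡⟨ W-onlyˡ nonempty-Kˡ nonempty-Kʳ ⟩
    W l Kˡ                                         ≡⟨ cong (W l) Kˡ≡⊤ ⟩
    W l ⊤                                          ≡⟨ W-full l ⟩
    2 * size l ∸ 2                                 ∎
    where
    open ≡-Reasoning
    open Node l r (leftLeaves (size l) (size r))
    parts : Kˡ ≡ ⊤ × Kʳ ≡ ⊥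
    parts = take-drop-++ ⊤ ⊥
    Kˡ≡⊤ : Kˡ ≡ ⊤
    Kˡ≡⊤ = proj₁ parts
    nonempty-Kˡ : nonempty Kˡ ≡ true
    nonempty-Kˡ = trans (cong nonempty Kˡ≡⊤) (nonempty-⊤ (1≤size l))
    nonempty-Kʳ : nonempty Kʳ ≡ false
    nonempty-Kʳ = trans (cong nonempty (proj₂ parts)) (nonempty-⊥ (size r))

  W-rightLeaves : W (node l r) (rightLeaves (size l) (size r)) ≡ 2 * size r ∸ 2
  W-rightLeaves = begin
    W (node l r) (rightLeaves (size l) (size r))  ≡⟨ W-onlyʳ nonempty-Kˡ nonempty-Kʳ ⟩
    W r Kʳ                                         ≡⟨ cong (W r) Kʳ≡⊤ ⟩
    W r ⊤                                          ≡⟨ W-full r ⟩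
    2 * size r ∸ 2                                 ∎
    where
    open ≡-Reasoning
    open Node l r (rightLeaves (size l) (size r))
    parts : Kˡ ≡ ⊥ × Kʳ ≡ ⊤
    parts = take-drop-++ ⊥ ⊤
    Kʳ≡⊤ : Kʳ ≡ ⊤
    Kʳ≡⊤ = proj₂ parts
    nonempty-Kˡ : nonempty Kˡ ≡ false
    nonempty-Kˡ = trans (cong nonempty (proj₁ parts)) (nonempty-⊥ (size l))
    nonempty-Kʳ : nonempty Kʳ ≡ true
    nonempty-Kʳ = trans (cong nonempty Kʳ≡⊤) (nonempty-⊤ (1≤size r))

  module _ (π : Permutation′ (size l + size r)) {k} (k≤n : k ≤ size l + size r) where

    firstK≡leftLeaves⇒tight : firstK π k ≡ leftLeaves (size l) (size r) → Wk (node l r) π k ≡ 2 * k ∸ 2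
    firstK≡leftLeaves⇒tight e = begin
      W (node l r) (firstK π k)                     ≡⟨ cong (W (node l r)) e ⟩
      W (node l r) (leftLeaves (size l) (size r))   ≡⟨ W-leftLeaves ⟩
      2 * size l ∸ 2                                ≡⟨ cong (λ a → 2 * a ∸ 2) k≡l ⟨
      2 * k ∸ 2                                     ∎
      where
      open ≡-Reasoning
      k≡l : k ≡ size l
      k≡l = trans (sym (∣firstK∣ π k≤n)) (trans (cong ∣_∣ e) (∣leftLeaves∣ (size l) (size r)))

    firstK≡rightLeaves⇒tight : firstK π k ≡ rightLeaves (size l) (size r) → Wk (node l r) π k ≡ 2 * k ∸ 2
    firstK≡rightLeaves⇒tight e = begin
      W (node l r) (firstK π k)                     ≡⟨ cong (W (node l r)) e ⟩
      W (node l r) (rightLeaves (size l) (size r))  ≡⟨ W-rightLeaves ⟩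
      2 * size r ∸ 2                                ≡⟨ cong (λ b → 2 * b ∸ 2) k≡r ⟨
      2 * k ∸ 2                                     ∎
      where
      open ≡-Reasoning
      k≡r : k ≡ size r
      k≡r = trans (sym (∣firstK∣ π k≤n)) (trans (cong ∣_∣ e) (∣rightLeaves∣ (size l) (size r)))

  reverse-SplitRL : SplitRL l r reverse (size r)
  reverse-SplitRL = below , above
    where
    n : ℕ
    n = size l + size r
    below : ∀ i → toℕ i < size r → size l ≤ toℕ (opposite i)
    below i i<r = begin
      size l                    ≤⟨ m≤m+n (size l) (size r ∸ suc (toℕ i)) ⟩
      size l + (size r ∸ suc (toℕ i)) ≡⟨ +-∸-assoc (size l) i<r ⟨
      n ∸ suc (toℕ i)           ≡⟨ opposite-prop i ⟨
      toℕ (opposite i)          ∎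
      where open ≤-Reasoning
    above : ∀ i → size r ≤ toℕ i → toℕ (opposite i) < size l
    above i r≤i = +-cancelʳ-< (suc (toℕ i)) (toℕ (opposite i)) (size l) (begin-strict
      toℕ (opposite i) + suc (toℕ i)   ≡⟨ cong (_+ suc (toℕ i)) (opposite-prop i) ⟩
      n ∸ suc (toℕ i) + suc (toℕ i)    ≡⟨ m∸n+n≡m (toℕ<n i) ⟩
      n                                <⟨ +-monoʳ-< (size l) (s≤s r≤i) ⟩
      size l + suc (toℕ i)             ∎)
      where open ≤-Reasoning

  leftFirst-admissible : Admissible (node l r) (size l)
  leftFirst-admissible = 1≤size l , m<m+n (size l) (1≤size r) , Perm.id ,
    firstK≡leftLeaves⇒tight Perm.id (m≤m+n (size l) (size r))
      (SplitLR⇒firstK l r Perm.id (size l) ((λ _ i<l → i<l) , (λ _ l≤i → l≤i)))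

  rightFirst-admissible : Admissible (node l r) (size r)
  rightFirst-admissible = 1≤size r , m<n+m (size r) (1≤size l) , reverse ,
    firstK≡rightLeaves⇒tight reverse (m≤n+m (size r) (size l))
      (SplitRL⇒firstK l r reverse (size r) reverse-SplitRL)

lemma6p22 : (T′ T″ : Tree) (m : ℕ) → IsSupAdm (node T′ T″) m →
    (π : Permutation′ (size (node T′ T″))) →
    ((Wk (node T′ T″) π m ≡ 2 * m ∸ 2 → SplitLR T′ T″ π m ⊎ SplitRL T′ T″ π m) ×
     (SplitLR T′ T″ π m ⊎ SplitRL T′ T″ π m → Wk (node T′ T″) π m ≡ 2 * m ∸ 2))
lemma6p22 l r m ((1≤m , m<n , _) , maximal) π = fwd , bwd
  where
  K : Subset (size l + size r)
  K = firstK π m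
  ∣K∣≡m : ∣ K ∣ ≡ m
  ∣K∣≡m = ∣firstK∣ π (<⇒≤ m<n)

  l≤m : size l ≤ m
  l≤m = maximal (size l) (leftFirst-admissible l r)
  r≤m : size r ≤ m
  r≤m = maximal (size r) (rightFirst-admissible l r)

  fwd : W (node l r) K ≡ 2 * m ∸ 2 → SplitLR l r π m ⊎ SplitRL l r π m
  fwd tight = Sum.map (firstK⇒SplitLR l r π m) (firstK⇒SplitRL l r π m)
    (tight⇒subtree l r K ∣K∣≡m m<n l≤m r≤m (trans (cong (_+ 2) tight) (m∸n+n≡m (*-monoʳ-≤ 2 1≤m))))

  bwd : SplitLR l r π m ⊎ SplitRL l r π m → W (node l r) K ≡ 2 * m ∸ 2
  bwd (inj₁ split) = firstK≡leftLeaves⇒tight l r π (<⇒≤ m<n) (SplitLR⇒firstK l r π m split)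
  bwd (inj₂ split) = firstK≡rightLeaves⇒tight l r π (<⇒≤ m<n) (SplitRL⇒firstK l r π m split)
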